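{- Let $\phi$ be a positive $\Lambda$-formula that is materializable, i.e. there is a pointed model $(C,x)$ such that for all positive $\Lambda$-formulas $\psi$, $x\models_C\psi$ iff $\phi\sqsubseteq\psi$. Then $\phi$ is strongly convex: $\phi$ is satisfiable, and whenever $\phi\sqsubseteq\bigvee_{i\in I}\psi_i$ for a (possibly infinite) index set $I$ and positive $\Lambda$-formulas $\psi_i$ (meaning $[\![\phi]\!]_D\subseteq\bigcup_{i\in I}[\![\psi_i]\!]_D$ for every coalgebra $D$), then $\phi\sqsubseteq\psi_i$ for some $i\in I$.
   Context: Fix an endofunctor $T$ on the category of sets that is non-trivial ($TX=\emptyset$ implies $X=\emptyset$) and preserves subsets. A similarity type $\Lambda$ is a set of modal operators $\heartsuit$ (treated as unary; atomic propositions are nullary operators), each interpreted by a monotone predicate lifting: a family of maps $[\![\heartsuit]\!]_X:\mathcal P(X)\to\mathcal P(TX)$, monotone and natural ($[\![\heartsuit]\!]_X(f^{ -1}[A])=(Tf)^{ -1}[[\![\heartsuit]\!]_Y(A)]$ for $f:X\to Y$). Write $t\models\heartsuit A$ for $t\in[\![\heartsuit]\!]_X(A)$. A model is a $T$-coalgebra $C=(X,\xi)$, $\xi:X\to TX$. Positive $\Lambda$-formulas: $\phi::=\top\mid\bot\mid\phi\wedge\phi\mid\phi\vee\phi\mid\heartsuit\phi$. Satisfaction: usual Boolean clauses and $x\models_C\heartsuit\phi$ iff $\xi(x)\models\heartsuit[\![\phi]\!]_C$ with $[\![\phi]\!]_C=\{x: x\models_C\phi\}$. Subsumption $\phi\sqsubseteq\psi$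 iff $[\![\phi]\!]_C\subseteq[\![\psi]\!]_C$ for all coalgebras $C$. -}

module Defs where

open import Level using (Level; 0ℓ) renaming (suc to lsuc)
open import Data.Product using (Σ; ∃; _×_; _,_)
open import Data.Empty using (⊥)
open import Function using (_∘_; id)
open import Relation.Binary.PropositionalEquality using (_≡_)

Subset : Set → Set₁
Subset X = X → Set

_⊆_ : {X : Set} → Subset X → Subset X → Set
A ⊆ B = ∀ x → A x → B x

preimage : {X Y : Set} → (X → Y) → Subset Y → Subset X
preimage f A = A ∘ f

record Functor : Set₁ where
  field
    F     : Set → Set
    fmap  : {X Y : Set} → (X → Y) → F X → F Y
    fmap-id : {X : Set} (t : F X) → fmap id t ≡ t
    fmap-∘  : {X Y Z : Set} (g : Y → Z) (f : X → Y) (t : F X) →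
              fmap (g ∘ f) t ≡ fmap g (fmap f t)

Injective : {X Y : Set} → (X → Y) → Set
Injective f = ∀ {a b} → f a ≡ f b → a ≡ b

record StandingAssumptions (T : Functor) : Set₁ where
  open Functor T
  field
    nonTrivial : {X : Set} → (F X → ⊥) → (X → ⊥)
    -- preserves subsets (inclusions), rendered as: T maps injections to injections
    preservesSubsets : {X Y : Set} (f : X → Y) → Injective f → Injective (fmap f)

record MonotoneLifting (T : Functor) : Set₁ where
  open Functor T
  field
    lift : {X : Set} → Subset X → Subset (F X)
    monotone : {X : Set} {A B : Subset X} → A ⊆ B → lift A ⊆ lift B
    natural : {X Y : Set} (f : X → Y) (A : Subset Y) (t : F X) →
              (lift (preimage f A) t → lift A (fmap f t)) ×
              (lift A (fmap f t) → lift (preimage f A) t)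

record Coalgebra (T : Functor) : Set₁ where
  constructor coalg
  open Functor T
  field
    Carrier : Set
    ξ       : Carrier → F Carrier

data Formula (Λ : Set) : Set where
  ⊤f ⊥f : Formula Λ
  _∧f_ _∨f_ : Formula Λ → Formula Λ → Formula Λ
  ◇ : Λ → Formula Λ → Formula Λ

module Semantics (T : Functor) (Λ : Set) (⟦_⟧ : Λ → MonotoneLifting T) where
  open Functor T
  open import Data.Unit using () renaming (⊤ to Unit)
  open import Data.Sum using (_⊎_)

  sat : (C : Coalgebra T) → Formula Λ → Subset (Coalgebra.Carrier C)
  sat C ⊤f x = Unit
  sat C ⊥f x = ⊥
  sat C (φ ∧f ψ) x = sat C φ x × sat C ψ x
  sat C (φ ∨f ψ) x = sat C φ x ⊎ sat C ψ x
  sat C (◇ h φ) x = MonotoneLifting.lift (⟦ h ⟧) (sat C φ) (Coalgebra.ξ C x)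

  _⊑_ : Formula Λ → Formula Λ → Set₁
  φ ⊑ ψ = (C : Coalgebra T) → sat C φ ⊆ sat C ψ

  _⊑⋁_ : Formula Λ → {I : Set} → (I → Formula Λ) → Set₁
  _⊑⋁_ φ {I} ψ = (D : Coalgebra T) (x : Coalgebra.Carrier D) →
                  sat D φ x → Σ I (λ i → sat D (ψ i) x)

  Satisfiable : Formula Λ → Set₁
  Satisfiable φ = Σ (Coalgebra T) (λ C → Σ (Coalgebra.Carrier C) (λ x → sat C φ x))

  Materializable : Formula Λ → Set₁
  Materializable φ = Σ (Coalgebra T) (λ C → Σ (Coalgebra.Carrier C) (λ x →
    (ψ : Formula Λ) → (sat C ψ x → φ ⊑ ψ) × (φ ⊑ ψ → sat C ψ x)))

  StronglyConvex : Formula Λ → Set₁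
  StronglyConvex φ = Satisfiable φ ×
    ((I : Set) (ψ : I → Formula Λ) → φ ⊑⋁ ψ → Σ I (λ i → φ ⊑ ψ i))

module Submission where

-- Let (C , x) materialize φ: the positive formulas true at x are exactly
-- those subsuming φ.  Since subsumption is reflexive, x satisfies φ, which
-- gives satisfiability.  Given a cover φ ⊑ ⋁ᵢ ψᵢ, evaluate it at the point
-- x of C: some ψᵢ holds at x, and by materialization φ ⊑ ψᵢ.
--
-- The argument uses nothing about T, the standing assumptions, or the
-- liftings beyond the definition of the semantics, so the lemmas below are
-- stated for an arbitrary functor and similarity type, and each separates
-- one direction of materialization: completeness gives satisfiability,
-- soundness gives convexity.

open import Defs
open import Data.Product using (Σ; _,_; proj₁; proj₂)

module _ (T : Functor) (Λ : Set) (⟦_⟧ : Λ → MonotoneLifting T) where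
  open Semantics T Λ ⟦_⟧

  ⊑-refl : (φ : Formula Λ) → φ ⊑ φ
  ⊑-refl φ D y holds = holds

  materializer-sat : (φ : Formula Λ) (C : Coalgebra T) (x : Coalgebra.Carrier C) →
    ((ψ : Formula Λ) → φ ⊑ ψ → sat C ψ x) → sat C φ x
  materializer-sat φ C x complete = complete φ (⊑-refl φ)

  cover-at-point : (φ : Formula Λ) (C : Coalgebra T) (x : Coalgebra.Carrier C) →
    ((ψ : Formula Λ) → sat C ψ x → φ ⊑ ψ) → sat C φ x →
    (I : Set) (ψ : I → Formula Λ) → φ ⊑⋁ ψ → Σ I (λ i → φ ⊑ ψ i)
  cover-at-point φ C x sound xφ I ψ cover =
    let (i , xψᵢ) = cover C x xφ in i , sound (ψ i) xψᵢ

lemma4p6 : (T : Functor) → StandingAssumptions T →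
    (Λ : Set) (⟦_⟧ : Λ → MonotoneLifting T) (φ : Formula Λ) →
    Semantics.Materializable T Λ ⟦_⟧ φ → Semantics.StronglyConvex T Λ ⟦_⟧ φ
lemma4p6 T _ Λ ⟦_⟧ φ (C , x , materializes) =
  (C , x , xφ) , cover-at-point T Λ ⟦_⟧ φ C x sound xφ
  where
    open Semantics T Λ ⟦_⟧

    sound : (ψ : Formula Λ) → sat C ψ x → φ ⊑ ψ
    sound ψ = proj₁ (materializes ψ)

    complete : (ψ : Formula Λ) → φ ⊑ ψ → sat C ψ x
    complete ψ = proj₂ (materializes ψ)

    xφ : sat C φ x
    xφ = materializer-sat T Λ ⟦_⟧ φ C x complete
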